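{- Let $(R,\mathcal P)$ be a partially ordered commutative ring and $\alpha,y_{\rm p},y_{\rm v},y_{\rm da},y_{\rm dd},y_{\rm fp},x\in R$. (a) If $1+\alpha\ge0$, $(1+\alpha)y_{\rm fp}\ge(1+\alpha)y_{\rm p}$, $y_{\rm p}\ge0$, $y_{\rm v}\ge0$ and $y_{\rm da}+y_{\rm dd}\ge y_{\rm p}+y_{\rm v}$, then the tridiagonal matrix $P^{\circ\flat}$ with $p^{\circ\flat}_{n,n+1}=1$, $p^{\circ\flat}_{n,n}=(1+\alpha)y_{\rm fp}+n(y_{\rm da}+y_{\rm dd})$, $p^{\circ\flat}_{n,n-1}=n(n+\alpha)y_{\rm p}y_{\rm v}$ and all other entries $0$ is totally positive in $R$. (b) If $1+\alpha\ge0$, $(1+\alpha)y_{\rm fp}=(1+\alpha)y_{\rm p}$, $y_{\rm p}\ge0$, $y_{\rm v}\ge0$, $y_{\rm da}+y_{\rm dd}\ge y_{\rm p}+y_{\rm v}$ and $x\ge0$, then the matrix $P^\flat$ with $p^\flat_{n,n+1}=1$, $p^\flat_{n,n}=(1+\alpha)y_{\rm fp}+n(y_{\rm da}+y_{\rm dd})+x$, $p^\flat_{n,n-1}=n(n+\alpha)y_{\rm p}y_{\rm v}+n(y_{\rm da}+y_{\rm dd})x$, $p^\flat_{n,n-2}=n(n-1)y_{\rm p}y_{\rm v}x$ and all other entries $0$ is totally positive in $R$. Both statements remain true when the roles of $y_{\rm p}$ and $y_{\rm v}$ are interchanged in the hypotheses.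
   Context: A partially ordered commutative ring is a commutative ring $R$ with $1\ne0$ and a subset $\mathcal P$ of nonnegative elements with $0,1\in\mathcal P$, $\mathcal P+\mathcal P\subseteq\mathcal P$, $\mathcal P\mathcal P\subseteq\mathcal P$, $\mathcal P\cap(-\mathcal P)=\{0\}$; $a\le b$ means $b-a\in\mathcal P$. A matrix is totally positive if all its minors are nonnegative. -}

module Defs where

open import Level using (Level; _⊔_)
open import Algebra.Bundles using (CommutativeRing)
open import Data.Nat as ℕ using (ℕ; zero; suc; _≟_)
open import Data.Fin as Fin using (Fin; zero; suc; punchIn)
open import Data.Product using (Σ; _×_)
open import Relation.Nullary using (¬_; yes; no)

-- Since stdlib rings carry a setoid equality _≈_,
-- we also require 𝒫 to respect _≈_.
record POCommRing (c ℓ p : Level) : Set (Level.suc (c ⊔ ℓ ⊔ p)) where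
  field
    commRing : CommutativeRing c ℓ
  open CommutativeRing commRing public hiding (zero)
  field
    𝒫        : Carrier → Set p
    𝒫-resp   : ∀ {x y} → x ≈ y → 𝒫 x → 𝒫 y
    1≉0      : ¬ (1# ≈ 0#)
    𝒫-0      : 𝒫 0#
    𝒫-1      : 𝒫 1#
    𝒫-+      : ∀ {x y} → 𝒫 x → 𝒫 y → 𝒫 (x + y)
    𝒫-*      : ∀ {x y} → 𝒫 x → 𝒫 y → 𝒫 (x * y)
    𝒫-antisym : ∀ {x} → 𝒫 x → 𝒫 (- x) → x ≈ 0#

  infix 4 _≤_ _≥_

  _≤_ : Carrier → Carrier → Set p
  a ≤ b = 𝒫 (b - a)

  _≥_ : Carrier → Carrier → Set p
  a ≥ b = b ≤ a

  ι : ℕ → Carrier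
  ι zero    = 0#
  ι (suc n) = 1# + ι n

  Σᶠ : ∀ {k} → (Fin k → Carrier) → Carrier
  Σᶠ {zero}  f = 0#
  Σᶠ {suc k} f = f zero + Σᶠ (λ i → f (suc i))

  sgn : ℕ → Carrier
  sgn zero    = 1#
  sgn (suc j) = - sgn j

  det : ∀ {k} → (Fin k → Fin k → Carrier) → Carrier
  det {zero}  M = 1#
  det {suc k} M =
    Σᶠ (λ j → sgn (Fin.toℕ j) * (M zero j * det (λ r s → M (suc r) (punchIn j s))))

  -- (ℕ × ℕ)-indexed matrices (rows and columns indexed from 0)
  Matrix : Set c
  Matrix = ℕ → ℕ → Carrier

  Increasing : ∀ {k} → (Fin k → ℕ) → Set
  Increasing {k} f = ∀ (i j : Fin k) → i Fin.< j → f i ℕ.< f j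

  minor : Matrix → ∀ {k} → (Fin k → ℕ) → (Fin k → ℕ) → Carrier
  minor A I J = det (λ r s → A (I r) (J s))

  TotallyPositive : Matrix → Set p
  TotallyPositive A =
    ∀ (k : ℕ) (I J : Fin k → ℕ) → Increasing I → Increasing J → 𝒫 (minor A I J)

  band : (u d l₁ l₂ : ℕ → Carrier) → Matrix
  band u d l₁ l₂ n m with m ≟ suc n
  ... | yes _ = u n
  ... | no _ with m ≟ n
  ... | yes _ = d n
  ... | no _ with suc m ≟ n
  ... | yes _ = l₁ n
  ... | no _ with suc (suc m) ≟ n
  ... | yes _ = l₂ n
  ... | no _ = 0#

  P∘♭ : (α yp yv yda ydd yfp : Carrier) → Matrix
  P∘♭ α yp yv yda ydd yfp =
    band (λ _ → 1#)
         (λ n → (1# + α) * yfp + ι n * (yda + ydd))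
         (λ n → ι n * (ι n + α) * yp * yv)
         (λ _ → 0#)

  P♭ : (α yp yv yda ydd yfp x : Carrier) → Matrix
  P♭ α yp yv yda ydd yfp x =
    band (λ _ → 1#)
         (λ n → (1# + α) * yfp + ι n * (yda + ydd) + x)
         (λ n → ι n * (ι n + α) * yp * yv + ι n * (yda + ydd) * x)
         (λ n → ι n * ι (n ℕ.∸ 1) * yp * yv * x)

{-# OPTIONS --safe #-}
module Submission where

-- Both matrices arise from the identity matrix by rounds of row combinations: row i of the
-- new matrix is a nonnegative combination of rows of the old one, and the rows feeding row i
-- all come before those feeding any later row. Such a round preserves total positivity: by
-- multilinearity a minor of the new matrix is a nonnegative combination of determinants of
-- the old one on weakly increasing rows, which are minors or vanish by a repeated row.
-- Let N_g have rows e_h and g_h e_h + e_{h+1} in positions 2h and 2h + 1, and let C_{b,c}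
-- turn M into the matrix with rows b_n M_{2n−1} + c_n M_{2n} + M_{2n+1}. With the slacks
-- f = (1+α) y_fp − (1+α) y_p ≥ 0 (zero in (b)) and t = y_da + y_dd − y_p − y_v ≥ 0,
--   P^{∘♭} = C_{b,c} N_g    for b_n = n y_v, c_n = f + n t, g_h = (h + 1 + α) y_p,
--   P^♭    = C_{b,c} Q N_x  for b_n = n y_v, c_n = n t,
-- where Q M has rows M_{2h−1} and the h-th row of C_{(h y_p)_h, (1+α) y_p} M in positions
-- 2h and 2h + 1. Both matrices are symmetric in y_p and y_v, which gives the variants.

open import Defs
open import Data.Bool using (Bool; true; false)
open import Data.Empty using (⊥-elim)
open import Data.Fin as Fin using (Fin; zero; suc; punchIn; toℕ; inject₁)
import Data.Fin.Properties as Finₚ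
open import Data.Nat as ℕ using (ℕ; zero; suc; z≤n; s≤s)
import Data.Nat.Properties as ℕₚ
open import Data.Product using (_×_; _,_; proj₁; proj₂; ∃)
open import Data.Sum using (_⊎_; inj₁; inj₂)
open import Data.Vec.Functional using (_∷_; []; updateAt)
open import Data.Vec.Functional.Properties using (updateAt-updates; updateAt-minimal)
open import Data.Vec.Functional.Relation.Unary.All using (All)
open import Function using (_∘_)
open import Relation.Binary.Definitions using (tri<; tri≈; tri>)
open import Relation.Binary.PropositionalEquality as ≡ using (_≡_; _≢_)
open import Relation.Nullary using (yes; no)

All₂ : ∀ {a p} {A : Set a} (P : A → Set p) {x y : A} → P x → P y → All P (x ∷ y ∷ [])
All₂ P px py zero       = px
All₂ P px py (suc zero) = py

All₃ : ∀ {a p} {A : Set a} (P : A → Set p) {x y z : A} → P x → P y → P z → All P (x ∷ y ∷ z ∷ [])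
All₃ P px py pz zero             = px
All₃ P px py pz (suc zero)       = py
All₃ P px py pz (suc (suc zero)) = pz

SourcesMonotone : ∀ {K} → (ℕ → Fin K → ℕ) → Set
SourcesMonotone src = ∀ i i' q q' → i ℕ.< i' → src i q ℕ.≤ src i' q'

module TotalPositivity {r ℓ p} (R : POCommRing r ℓ p) where
  open POCommRing R
  open import Relation.Binary.Reasoning.Setoid setoid
  open import Algebra.Properties.Ring ring using (-‿distribˡ-*; -‿distribʳ-*)
  open import Algebra.Properties.Group +-group using () renaming (⁻¹-involutive to -‿involutive)
  open import Algebra.Solver.Ring.NaturalCoefficients.Default commutativeSemiring

  Σᶠ-cong : ∀ {k} {f g : Fin k → Carrier} → (∀ i → f i ≈ g i) → Σᶠ f ≈ Σᶠ g
  Σᶠ-cong {zero}  f≈g = refl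
  Σᶠ-cong {suc k} f≈g = +-cong (f≈g zero) (Σᶠ-cong (λ i → f≈g (suc i)))

  Σᶠ-zero : ∀ {k} {f : Fin k → Carrier} → (∀ i → f i ≈ 0#) → Σᶠ f ≈ 0#
  Σᶠ-zero {zero}  f≈0 = refl
  Σᶠ-zero {suc k} f≈0 = trans (+-cong (f≈0 zero) (Σᶠ-zero (λ i → f≈0 (suc i)))) (+-identityˡ 0#)

  Σᶠ-distrib-+ : ∀ {k} (f g : Fin k → Carrier) → Σᶠ (λ i → f i + g i) ≈ Σᶠ f + Σᶠ g
  Σᶠ-distrib-+ {zero}  f g = sym (+-identityˡ 0#)
  Σᶠ-distrib-+ {suc k} f g = trans (+-cong refl (Σᶠ-distrib-+ (λ i → f (suc i)) (λ i → g (suc i))))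
    (solve 4 (λ a b c d → (a :+ b) :+ (c :+ d) := (a :+ c) :+ (b :+ d)) refl (f zero) (g zero) _ _)

  *-distribˡ-Σᶠ : ∀ {k} a (f : Fin k → Carrier) → a * Σᶠ f ≈ Σᶠ (λ i → a * f i)
  *-distribˡ-Σᶠ {zero}  a f = zeroʳ a
  *-distribˡ-Σᶠ {suc k} a f = trans (distribˡ a (f zero) _) (+-cong refl (*-distribˡ-Σᶠ a (λ i → f (suc i))))

  *-distribʳ-Σᶠ : ∀ {k} a (f : Fin k → Carrier) → Σᶠ f * a ≈ Σᶠ (λ i → f i * a)
  *-distribʳ-Σᶠ a f = trans (*-comm _ a) (trans (*-distribˡ-Σᶠ a f) (Σᶠ-cong (λ i → *-comm a (f i))))

  Σᶠ-comm : ∀ {k m} (F : Fin k → Fin m → Carrier) →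
    Σᶠ (λ i → Σᶠ (F i)) ≈ Σᶠ (λ j → Σᶠ (λ i → F i j))
  Σᶠ-comm {zero}  {m} F = sym (Σᶠ-zero {m} (λ j → refl))
  Σᶠ-comm {suc k} {m} F = trans (+-cong refl (Σᶠ-comm (λ i → F (suc i))))
    (sym (Σᶠ-distrib-+ (F zero) (λ j → Σᶠ (λ i → F (suc i) j))))

  Σᶠ-𝒫 : ∀ {k} {f : Fin k → Carrier} → (∀ i → 𝒫 (f i)) → 𝒫 (Σᶠ f)
  Σᶠ-𝒫 {zero}  f≥0 = 𝒫-0
  Σᶠ-𝒫 {suc k} f≥0 = 𝒫-+ (f≥0 zero) (Σᶠ-𝒫 (λ i → f≥0 (suc i)))

  SquareMatrix : ℕ → Set r
  SquareMatrix k = Fin k → Fin k → Carrier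

  det-cong : ∀ {k} {X Y : SquareMatrix k} → (∀ r s → X r s ≈ Y r s) → det X ≈ det Y
  det-cong {zero}  X≈Y = refl
  det-cong {suc k} X≈Y = Σᶠ-cong λ j →
    *-cong (refl {sgn (toℕ j)}) (*-cong (X≈Y zero j) (det-cong (λ r s → X≈Y (suc r) (punchIn j s))))

  minor₀ : ∀ {k} → SquareMatrix (suc k) → Fin (suc k) → SquareMatrix k
  minor₀ X j r s = X (suc r) (punchIn j s)

  laplaceTerm : ∀ {k} → SquareMatrix (suc k) → Fin (suc k) → Carrier
  laplaceTerm X j = sgn (toℕ j) * (X zero j * det (minor₀ X j))

  det-combination-byLaplaceTerms : ∀ {k K} (X : SquareMatrix (suc k)) (Y : Fin K → SquareMatrix (suc k))
    (a : Fin K → Carrier) → (∀ j → laplaceTerm X j ≈ Σᶠ (λ q → a q * laplaceTerm (Y q) j)) →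
    det X ≈ Σᶠ (λ q → a q * det (Y q))
  det-combination-byLaplaceTerms X Y a terms = begin
    det X                                                    ≈⟨ Σᶠ-cong terms ⟩
    Σᶠ (λ j → Σᶠ (λ q → a q * laplaceTerm (Y q) j))
      ≈⟨ Σᶠ-comm (λ j q → a q * laplaceTerm (Y q) j) ⟩
    Σᶠ (λ q → Σᶠ (λ j → a q * laplaceTerm (Y q) j))
      ≈⟨ Σᶠ-cong (λ q → sym (*-distribˡ-Σᶠ (a q) (laplaceTerm (Y q)))) ⟩
    Σᶠ (λ q → a q * det (Y q))                               ∎

  det-rowLinear : ∀ {k K} (X : SquareMatrix k) (Y : Fin K → SquareMatrix k) (a : Fin K → Carrier)
    (r : Fin k) → (∀ s → X r s ≈ Σᶠ (λ q → a q * Y q r s)) →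
    (∀ q r' s → r' ≢ r → X r' s ≈ Y q r' s) →
    det X ≈ Σᶠ (λ q → a q * det (Y q))
  det-rowLinear {suc k} {K} X Y a zero row₀ others = det-combination-byLaplaceTerms X Y a λ j →
    let D = det (minor₀ X j) in begin
    sgn (toℕ j) * (X zero j * D)                       ≈⟨ *-cong refl (*-cong (row₀ j) refl) ⟩
    sgn (toℕ j) * (Σᶠ (λ q → a q * Y q zero j) * D)    ≈⟨ *-cong refl (*-distribʳ-Σᶠ {K} D _) ⟩
    sgn (toℕ j) * Σᶠ (λ q → a q * Y q zero j * D)      ≈⟨ *-distribˡ-Σᶠ {K} (sgn (toℕ j)) _ ⟩
    Σᶠ (λ q → sgn (toℕ j) * (a q * Y q zero j * D))    ≈⟨ Σᶠ-cong (λ q → trans (rearrange _ _ _ _)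
                                                           (*-cong refl (*-cong refl (*-cong refl
                                                             (det-cong (λ r s → others q (suc r) _ λ ())))))) ⟩
    Σᶠ (λ q → a q * laplaceTerm (Y q) j)               ∎
    where
    rearrange : ∀ σ α y d → σ * (α * y * d) ≈ α * (σ * (y * d))
    rearrange = solve 4 (λ σ α y d → σ :* (α :* y :* d) := α :* (σ :* (y :* d))) refl
  det-rowLinear {suc k} {K} X Y a (suc r) rowᵣ others = det-combination-byLaplaceTerms X Y a λ j → begin
    sgn (toℕ j) * (X zero j * det (minor₀ X j))
      ≈⟨ *-cong refl (*-cong refl (det-rowLinear (minor₀ X j) (λ q → minor₀ (Y q) j) a r
           (λ s → rowᵣ (punchIn j s))
           (λ q r' s r'≢r → others q (suc r') _ (r'≢r ∘ Finₚ.suc-injective)))) ⟩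
    sgn (toℕ j) * (X zero j * Σᶠ (λ q → a q * det (minor₀ (Y q) j)))
      ≈⟨ *-cong refl (*-distribˡ-Σᶠ {K} (X zero j) _) ⟩
    sgn (toℕ j) * Σᶠ (λ q → X zero j * (a q * det (minor₀ (Y q) j)))
      ≈⟨ *-distribˡ-Σᶠ {K} (sgn (toℕ j)) _ ⟩
    Σᶠ (λ q → sgn (toℕ j) * (X zero j * (a q * det (minor₀ (Y q) j))))
      ≈⟨ Σᶠ-cong (λ q → trans (rearrange _ _ _ _)
                               (*-cong refl (*-cong refl (*-cong (others q zero j λ ()) refl)))) ⟩
    Σᶠ (λ q → a q * laplaceTerm (Y q) j) ∎
    where
    rearrange : ∀ σ x α d → σ * (x * (α * d)) ≈ α * (σ * (x * d))
    rearrange = solve 4 (λ σ x α d → σ :* (x :* (α :* d)) := α :* (σ :* (x :* d))) refl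

  -- In the double expansion of det X along rows 0 and 1, the term taking column u from
  -- row 0 and column punchIn u w from row 1 cancels the term taking them the other way
  -- round; twin u w is the index of column u once punchIn u w is removed.
  twin : ∀ {m} → Fin (suc m) → Fin m → Fin m
  twin {suc m} zero    w       = zero
  twin {suc m} (suc u) zero    = u
  twin {suc m} (suc u) (suc w) = suc (twin u w)

  punchIn-twin : ∀ {m} (u : Fin (suc m)) (w : Fin m) → punchIn (punchIn u w) (twin u w) ≡ u
  punchIn-twin {suc m} zero    w       = ≡.refl
  punchIn-twin {suc m} (suc u) zero    = ≡.refl
  punchIn-twin {suc m} (suc u) (suc w) = ≡.cong suc (punchIn-twin u w)

  punchIn-punchIn-twin : ∀ {m} (u : Fin (suc (suc m))) (w : Fin (suc m)) (b : Fin m) →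
    punchIn (punchIn u w) (punchIn (twin u w) b) ≡ punchIn u (punchIn w b)
  punchIn-punchIn-twin zero    w       b       = ≡.refl
  punchIn-punchIn-twin (suc u) zero    b       = ≡.refl
  punchIn-punchIn-twin {suc m} (suc u) (suc w) zero    = ≡.refl
  punchIn-punchIn-twin {suc m} (suc u) (suc w) (suc b) = ≡.cong suc (punchIn-punchIn-twin u w b)

  -x*-y≈x*y : ∀ x y → - x * - y ≈ x * y
  -x*-y≈x*y x y = begin
    - x * - y       ≈⟨ -‿distribˡ-* x (- y) ⟨
    - (x * - y)     ≈⟨ -‿cong (-‿distribʳ-* x y) ⟨
    - (- (x * y))   ≈⟨ -‿involutive (x * y) ⟩
    x * y           ∎

  sgn-twin : ∀ {m} (u : Fin (suc m)) (w : Fin m) →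
    sgn (toℕ (punchIn u w)) * sgn (toℕ (twin u w)) ≈ - (sgn (toℕ u) * sgn (toℕ w))
  sgn-twin {suc m} zero    w       = trans (*-identityʳ _) (-‿cong (sym (*-identityˡ _)))
  sgn-twin {suc m} (suc u) zero    = trans (*-identityˡ _)
    (trans (sym (-‿involutive _)) (-‿cong (sym (*-identityʳ _))))
  sgn-twin {suc m} (suc u) (suc w) = begin
    - sgn (toℕ (punchIn u w)) * - sgn (toℕ (twin u w))   ≈⟨ -x*-y≈x*y _ _ ⟩
    sgn (toℕ (punchIn u w)) * sgn (toℕ (twin u w))       ≈⟨ sgn-twin u w ⟩
    - (sgn (toℕ u) * sgn (toℕ w))                        ≈⟨ -‿cong (-x*-y≈x*y _ _) ⟨
    - (- sgn (toℕ u) * - sgn (toℕ w))                    ∎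

  Σᶠ-twinsCancel : ∀ {m} (T : Fin (suc m) → Fin m → Carrier) →
    (∀ u w → T u w + T (punchIn u w) (twin u w) ≈ 0#) → Σᶠ (λ u → Σᶠ (T u)) ≈ 0#
  Σᶠ-twinsCancel {zero}  T cancel = +-identityˡ 0#
  Σᶠ-twinsCancel {suc m} T cancel = begin
    Σᶠ (T zero) + Σᶠ (λ u → T (suc u) zero + Σᶠ (λ w → T (suc u) (suc w)))
      ≈⟨ +-cong refl (Σᶠ-distrib-+ (λ u → T (suc u) zero) (λ u → Σᶠ (λ w → T (suc u) (suc w)))) ⟩
    Σᶠ (T zero) + (Σᶠ (λ u → T (suc u) zero) + Σᶠ (λ u → Σᶠ (λ w → T (suc u) (suc w))))
      ≈⟨ +-assoc _ _ _ ⟨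
    (Σᶠ (T zero) + Σᶠ (λ u → T (suc u) zero)) + Σᶠ (λ u → Σᶠ (λ w → T (suc u) (suc w)))
      ≈⟨ +-cong (Σᶠ-distrib-+ (T zero) (λ u → T (suc u) zero)) refl ⟨
    Σᶠ (λ w → T zero w + T (suc w) zero) + Σᶠ (λ u → Σᶠ (λ w → T (suc u) (suc w)))
      ≈⟨ +-cong (Σᶠ-zero (cancel zero))
                (Σᶠ-twinsCancel (λ u w → T (suc u) (suc w)) (λ u w → cancel (suc u) (suc w))) ⟩
    0# + 0#
      ≈⟨ +-identityˡ 0# ⟩
    0# ∎

  det-equalFirstRows : ∀ {k} (X : SquareMatrix (suc (suc k))) → (∀ s → X zero s ≈ X (suc zero) s) → det X ≈ 0#
  det-equalFirstRows {k} X row₀≈row₁ = trans (Σᶠ-cong expand) (Σᶠ-twinsCancel T cancel)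
    where
    Z : Fin (suc (suc k)) → Fin (suc k) → SquareMatrix k
    Z u w r s = X (suc (suc r)) (punchIn u (punchIn w s))
    T : Fin (suc (suc k)) → Fin (suc k) → Carrier
    T u w = (sgn (toℕ u) * sgn (toℕ w)) * ((X zero u * X zero (punchIn u w)) * det (Z u w))
    expand : ∀ u → laplaceTerm X u ≈ Σᶠ (T u)
    expand u = begin
      sgn (toℕ u) * (X zero u * det (minor₀ X u))
        ≈⟨ *-cong refl (*-distribˡ-Σᶠ (X zero u) (laplaceTerm (minor₀ X u))) ⟩
      sgn (toℕ u) * Σᶠ (λ w → X zero u * laplaceTerm (minor₀ X u) w)
        ≈⟨ *-distribˡ-Σᶠ (sgn (toℕ u)) (λ w → X zero u * laplaceTerm (minor₀ X u) w) ⟩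
      Σᶠ (λ w → sgn (toℕ u) * (X zero u * laplaceTerm (minor₀ X u) w))
        ≈⟨ Σᶠ-cong {suc k} (λ w → trans (rearrange (sgn (toℕ u)) (X zero u) (sgn (toℕ w)) _ (det (Z u w)))
             (*-cong refl (*-cong (*-cong refl (sym (row₀≈row₁ (punchIn u w)))) refl))) ⟩
      Σᶠ (T u) ∎
      where
      rearrange : ∀ σ x τ y d → σ * (x * (τ * (y * d))) ≈ (σ * τ) * ((x * y) * d)
      rearrange = solve 5 (λ σ x τ y d → σ :* (x :* (τ :* (y :* d))) := (σ :* τ) :* ((x :* y) :* d)) refl
    cancel : ∀ u w → T u w + T (punchIn u w) (twin u w) ≈ 0#
    cancel u w = begin
      T u w + T v (twin u w)
        ≈⟨ +-cong refl (*-cong (sgn-twin u w) (*-cong (*-cong refl (reflexive (≡.cong (X zero) (punchIn-twin u w))))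
             (det-cong (λ r s → reflexive (≡.cong (X (suc (suc r))) (punchIn-punchIn-twin u w s)))))) ⟩
      σ * (x * y * D) + - σ * (y * x * D)
        ≈⟨ +-cong refl (trans (sym (-‿distribˡ-* _ _)) (-‿cong (*-cong refl (*-cong (*-comm y x) refl)))) ⟩
      σ * (x * y * D) + - (σ * (x * y * D))
        ≈⟨ -‿inverseʳ _ ⟩
      0# ∎
      where
      v : Fin (suc (suc k))
      v = punchIn u w
      σ x y D : Carrier
      σ = sgn (toℕ u) * sgn (toℕ w)
      x = X zero u
      y = X zero v
      D = det (Z u w)

  det-equalAdjacentRows : ∀ {k} (X : SquareMatrix (suc k)) (r : Fin k) →
    (∀ s → X (inject₁ r) s ≈ X (suc r) s) → det X ≈ 0#
  det-equalAdjacentRows X zero    rows≈ = det-equalFirstRows X rows≈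
  det-equalAdjacentRows X (suc r) rows≈ = Σᶠ-zero {f = laplaceTerm X} λ j →
    trans (*-cong refl (*-cong refl (det-equalAdjacentRows (minor₀ X j) r (λ s → rows≈ (punchIn j s)))))
          (trans (*-cong refl (zeroʳ _)) (zeroʳ _))

  det-zeroColumn : ∀ {k} (X : SquareMatrix k) (s : Fin k) → (∀ r → X r s ≈ 0#) → det X ≈ 0#
  det-zeroColumn {suc k} X s col≈0 = Σᶠ-zero {f = laplaceTerm X} term≈0
    where
    term≈0 : ∀ j → laplaceTerm X j ≈ 0#
    term≈0 j with j Fin.≟ s
    ... | yes ≡.refl = trans (*-cong refl (trans (*-cong (col≈0 zero) refl) (zeroˡ _))) (zeroʳ _)
    ... | no j≢s     = trans (*-cong refl (trans (*-cong refl
            (det-zeroColumn (minor₀ X j) (Fin.punchOut j≢s)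
              (λ r → trans (reflexive (≡.cong (X (suc r)) (Finₚ.punchIn-punchOut j≢s))) (col≈0 (suc r)))))
            (zeroʳ _))) (zeroʳ _)

  det-zeroFirstRow : ∀ {k} (X : SquareMatrix (suc k)) → (∀ s → X zero s ≈ 0#) → det X ≈ 0#
  det-zeroFirstRow X row≈0 = Σᶠ-zero {f = laplaceTerm X} λ j →
    trans (*-cong refl (trans (*-cong (row≈0 j) refl) (zeroˡ _))) (zeroʳ _)

  det-unitFirstRow : ∀ {k} (X : SquareMatrix (suc k)) → X zero zero ≈ 1# → (∀ s → X zero (suc s) ≈ 0#) →
    det X ≈ det (λ r s → X (suc r) (suc s))
  det-unitFirstRow X x₀₀≈1 x₀ₛ≈0 = begin
    1# * (X zero zero * D) + Σᶠ (λ j → laplaceTerm X (suc j))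
      ≈⟨ +-cong (trans (*-identityˡ _) (trans (*-cong x₀₀≈1 refl) (*-identityˡ D)))
                (Σᶠ-zero λ j → trans (*-cong refl (trans (*-cong (x₀ₛ≈0 j) refl) (zeroˡ _))) (zeroʳ _)) ⟩
    D + 0#
      ≈⟨ +-identityʳ D ⟩
    D ∎
    where
    D : Carrier
    D = det (λ r s → X (suc r) (suc s))

  δ : Matrix
  δ zero    zero    = 1#
  δ zero    (suc _) = 0#
  δ (suc _) zero    = 0#
  δ (suc i) (suc j) = δ i j

  δ-diagonal : ∀ i → δ i i ≡ 1#
  δ-diagonal zero    = ≡.refl
  δ-diagonal (suc i) = δ-diagonal i

  ≢⇒δ≡0 : ∀ {i j} → i ≢ j → δ i j ≡ 0#
  ≢⇒δ≡0 {zero}  {zero}  i≢j = ⊥-elim (i≢j ≡.refl)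
  ≢⇒δ≡0 {zero}  {suc j} i≢j = ≡.refl
  ≢⇒δ≡0 {suc i} {zero}  i≢j = ≡.refl
  ≢⇒δ≡0 {suc i} {suc j} i≢j = ≢⇒δ≡0 (i≢j ∘ ≡.cong suc)

  Increasing-head≤ : ∀ {k} (I : Fin (suc k) → ℕ) → Increasing I → ∀ r → I zero ℕ.≤ I r
  Increasing-head≤ I I↑ zero    = ℕₚ.≤-refl
  Increasing-head≤ I I↑ (suc r) = ℕₚ.<⇒≤ (I↑ zero (suc r) (s≤s z≤n))

  Increasing-tail : ∀ {k} (I : Fin (suc k) → ℕ) → Increasing I → Increasing (I ∘ suc)
  Increasing-tail I I↑ i j i<j = I↑ (suc i) (suc j) (s≤s i<j)

  Increasing-fromAdjacent : ∀ {k} (I : Fin (suc k) → ℕ) →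
    (∀ r → I (inject₁ r) ℕ.< I (suc r)) → Increasing I
  Increasing-fromAdjacent {suc k} I adj zero    (suc zero)    _         = adj zero
  Increasing-fromAdjacent {suc k} I adj zero    (suc (suc j)) _         =
    ℕₚ.<-trans (adj zero) (Increasing-fromAdjacent (I ∘ suc) (adj ∘ suc) zero (suc j) (s≤s z≤n))
  Increasing-fromAdjacent {suc k} I adj (suc i) (suc j)       (s≤s i<j) =
    Increasing-fromAdjacent (I ∘ suc) (adj ∘ suc) i j i<j

  δ-TP : TotallyPositive δ
  δ-TP zero    I J I↑ J↑ = 𝒫-1
  δ-TP (suc k) I J I↑ J↑ with ℕₚ.<-cmp (J zero) (I zero)
  ... | tri< J₀<I₀ _ _ = 𝒫-resp (sym (det-zeroColumn (λ r s → δ (I r) (J s)) zero λ r →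
          reflexive (≢⇒δ≡0 (ℕₚ.>⇒≢ (ℕₚ.<-≤-trans J₀<I₀ (Increasing-head≤ I I↑ r))))))
          𝒫-0
  ... | tri> _ _ I₀<J₀ = 𝒫-resp (sym (det-zeroFirstRow (λ r s → δ (I r) (J s)) λ s →
          reflexive (≢⇒δ≡0 (ℕₚ.<⇒≢ (ℕₚ.<-≤-trans I₀<J₀ (Increasing-head≤ J J↑ s))))))
          𝒫-0
  ... | tri≈ _ J₀≡I₀ _ = 𝒫-resp (sym (det-unitFirstRow (λ r s → δ (I r) (J s))
          (reflexive (≡.trans (≡.cong (δ (I zero)) J₀≡I₀) (δ-diagonal (I zero))))
          (λ s → reflexive (≢⇒δ≡0 (ℕₚ.<⇒≢ (ℕₚ.≤-<-trans (ℕₚ.≤-reflexive (≡.sym J₀≡I₀))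
                                                              (J↑ zero (suc s) (s≤s z≤n))))))))
          (δ-TP k (I ∘ suc) (J ∘ suc) (Increasing-tail I I↑) (Increasing-tail J J↑))

  TotallyPositive-resp : ∀ {M M' : Matrix} → (∀ i j → M i j ≈ M' i j) → TotallyPositive M → TotallyPositive M'
  TotallyPositive-resp M≈M' M-TP k I J I↑ J↑ =
    𝒫-resp (det-cong (λ r s → M≈M' (I r) (J s))) (M-TP k I J I↑ J↑)

  -- A repeated row makes the minor vanish.
  TotallyPositive-nondecreasingRows : ∀ {M : Matrix} → TotallyPositive M →
    ∀ {k} (ρ J : Fin k → ℕ) → (∀ r r' → r Fin.< r' → ρ r ℕ.≤ ρ r') → Increasing J →
    𝒫 (det (λ r s → M (ρ r) (J s)))
  TotallyPositive-nondecreasingRows M-TP {zero}  ρ J ρ↑ J↑ = 𝒫-1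
  TotallyPositive-nondecreasingRows {M} M-TP {suc k} ρ J ρ↑ J↑
    with Finₚ.any? (λ r → ρ (inject₁ r) ℕ.≟ ρ (suc r))
  ... | yes (r , ρᵣ≡ρᵣ₊₁) = 𝒫-resp (sym (det-equalAdjacentRows (λ r s → M (ρ r) (J s)) r
          (λ s → reflexive (≡.cong (λ i → M i (J s)) ρᵣ≡ρᵣ₊₁)))) 𝒫-0
  ... | no  noRepeat      = M-TP (suc k) ρ J (Increasing-fromAdjacent ρ adjacent) J↑
    where
    adjacent : ∀ r → ρ (inject₁ r) ℕ.< ρ (suc r)
    adjacent r = ℕₚ.≤∧≢⇒< (ρ↑ (inject₁ r) (suc r) (s≤s (ℕₚ.≤-reflexive (Finₚ.toℕ-inject₁ r))))
                          (λ ρᵣ≡ρᵣ₊₁ → noRepeat (r , ρᵣ≡ρᵣ₊₁))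

  rowCombination : ∀ {K} → (ℕ → Fin K → Carrier) → (ℕ → Fin K → ℕ) → Matrix → Matrix
  rowCombination a src M i j = Σᶠ (λ q → a i q * M (src i q) j)

  -- Induction on the number m of leading rows that are still combinations: linearity in
  -- row m reduces m + 1 to m.
  det-rowCombinations-𝒫 : ∀ {k K} (a : Fin k → Fin K → Carrier) (V : Fin k → Fin K → Fin k → Carrier) →
    (∀ r q → 𝒫 (a r q)) → (∀ (χ : Fin k → Fin K) → 𝒫 (det (λ r → V r (χ r)))) →
    𝒫 (det (λ r s → Σᶠ (λ q → a r q * V r q s)))
  det-rowCombinations-𝒫 {k} {K} a V a≥0 V≥0 =
    expanded k ℕₚ.≤-refl N (λ _ _ _ → refl) (λ r k≤r → ⊥-elim (ℕₚ.<⇒≱ (Finₚ.toℕ<n r) k≤r))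
    where
    N : SquareMatrix k
    N r s = Σᶠ (λ q → a r q * V r q s)
    expanded : ∀ m → m ℕ.≤ k → (X : SquareMatrix k) →
      (∀ r → toℕ r ℕ.< m → ∀ s → X r s ≈ N r s) →
      (∀ r → m ℕ.≤ toℕ r → ∃ λ q → ∀ s → X r s ≈ V r q s) → 𝒫 (det X)
    expanded zero    _   X _        single =
      𝒫-resp (det-cong (λ r → sym ∘ proj₂ (single r z≤n))) (V≥0 (λ r → proj₁ (single r z≤n)))
    expanded (suc m) m<k X combined single =
      𝒫-resp (sym (det-rowLinear X Y (a r₀) r₀ rowᵣ₀ (λ q r s r≢r₀ → unchanged q r r≢r₀ s)))
             (Σᶠ-𝒫 (λ q → 𝒫-* (a≥0 r₀ q) (expanded m (ℕₚ.<⇒≤ m<k) (Y q) (combinedY q) (singleY q))))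
      where
      r₀ : Fin k
      r₀ = Fin.fromℕ< m<k
      toℕ-r₀ : toℕ r₀ ≡ m
      toℕ-r₀ = Finₚ.toℕ-fromℕ< m<k
      r₀<suc-m : toℕ r₀ ℕ.< suc m
      r₀<suc-m = s≤s (ℕₚ.≤-reflexive toℕ-r₀)
      Y : Fin K → SquareMatrix k
      Y q = updateAt X r₀ (λ _ → V r₀ q)
      updated : ∀ q s → Y q r₀ s ≈ V r₀ q s
      updated q s = reflexive (≡.cong-app (updateAt-updates r₀ X) s)
      rowᵣ₀ : ∀ s → X r₀ s ≈ Σᶠ (λ q → a r₀ q * Y q r₀ s)
      rowᵣ₀ s = trans (combined r₀ r₀<suc-m s) (Σᶠ-cong (λ q → *-cong refl (sym (updated q s))))
      unchanged : ∀ q r → r ≢ r₀ → ∀ s → X r s ≈ Y q r s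
      unchanged q r r≢r₀ s = reflexive (≡.sym (≡.cong-app (updateAt-minimal r r₀ X r≢r₀) s))
      combinedY : ∀ q r → toℕ r ℕ.< m → ∀ s → Y q r s ≈ N r s
      combinedY q r r<m s = trans (sym (unchanged q r (λ { ≡.refl → ℕₚ.<-irrefl toℕ-r₀ r<m }) s))
                                  (combined r (ℕₚ.m<n⇒m<1+n r<m) s)
      singleY : ∀ q r → m ℕ.≤ toℕ r → ∃ λ q' → ∀ s → Y q r s ≈ V r q' s
      singleY q r m≤r with r Fin.≟ r₀
      ... | yes ≡.refl = q , updated q
      ... | no r≢r₀    =
        proj₁ (single r m<r) , λ s → trans (sym (unchanged q r r≢r₀ s)) (proj₂ (single r m<r) s)
        where
        m<r : suc m ℕ.≤ toℕ r
        m<r = ℕₚ.≤∧≢⇒< m≤r λ m≡r → r≢r₀ (Finₚ.toℕ-injective (≡.trans (≡.sym m≡r) (≡.sym toℕ-r₀)))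

  TotallyPositive-rowCombination : ∀ {K} {a : ℕ → Fin K → Carrier} {src : ℕ → Fin K → ℕ} {M : Matrix} →
    (∀ i q → 𝒫 (a i q)) → SourcesMonotone src → TotallyPositive M → TotallyPositive (rowCombination a src M)
  TotallyPositive-rowCombination {a = a} {src} {M} a≥0 src↑ M-TP k I J I↑ J↑ =
    det-rowCombinations-𝒫 (λ r → a (I r)) (λ r q s → M (src (I r) q) (J s)) (λ r → a≥0 (I r)) λ χ →
      TotallyPositive-nondecreasingRows {M} M-TP (λ r → src (I r) (χ r)) J
        (λ r r' r<r' → src↑ (I r) (I r') (χ r) (χ r') (I↑ r r' r<r')) J↑

sourcesMonotone-byIntervals : ∀ {K} (src : ℕ → Fin K → ℕ) (lo hi : ℕ → ℕ) →
  (∀ i → All (lo i ℕ.≤_) (src i)) → (∀ i → All (ℕ._≤ hi i) (src i)) →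
  (∀ i i' → i ℕ.< i' → hi i ℕ.≤ lo i') → SourcesMonotone src
sourcesMonotone-byIntervals src lo hi lo≤ ≤hi hi≤lo i i' q q' i<i' =
  ℕₚ.≤-trans (≤hi i q) (ℕₚ.≤-trans (hi≤lo i i' i<i') (lo≤ i' q'))

halve : ℕ → ℕ × Bool
halve zero    = 0 , false
halve (suc n) with halve n
... | h , false = h , true
... | h , true  = suc h , false

halve-even : ∀ h → halve (h ℕ.+ h) ≡ (h , false)
halve-even zero = ≡.refl
halve-even (suc h) rewrite ℕₚ.+-suc h h | halve-even h = ≡.refl

halve-odd : ∀ h → halve (suc (h ℕ.+ h)) ≡ (h , true)
halve-odd h rewrite halve-even h = ≡.refl

half : ℕ → ℕ
half n = proj₁ (halve n)

half-≤-suc : ∀ n → half n ℕ.≤ half (suc n)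
half-≤-suc n with halve n
... | h , false = ℕₚ.≤-refl
... | h , true  = ℕₚ.n≤1+n h

half-mono : ∀ {m n} → m ℕ.≤ n → half m ℕ.≤ half n
half-mono m≤n = go (ℕₚ.≤⇒≤′ m≤n)
  where
  go : ∀ {m n} → m ℕ.≤′ n → half m ℕ.≤ half n
  go ℕ.≤′-refl            = ℕₚ.≤-refl
  go (ℕ.≤′-step {n} m≤′n) = ℕₚ.≤-trans (go m≤′n) (half-≤-suc n)

-- 2h − 1, with the junk value 0 at h = 0
prevOdd : ℕ → ℕ
prevOdd zero    = zero
prevOdd (suc h) = suc (h ℕ.+ h)

prevOdd-mono : ∀ {m n} → m ℕ.≤ n → prevOdd m ℕ.≤ prevOdd n
prevOdd-mono {zero}  _         = z≤n
prevOdd-mono {suc m} (s≤s m≤n) = s≤s (ℕₚ.+-mono-≤ m≤n m≤n)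

prevOdd-≤-double : ∀ h → prevOdd h ℕ.≤ h ℕ.+ h
prevOdd-≤-double zero    = z≤n
prevOdd-≤-double (suc h) = s≤s (ℕₚ.+-monoʳ-≤ h (ℕₚ.n≤1+n h))

prevOdd-≤-suc-double : ∀ h → prevOdd h ℕ.≤ suc (h ℕ.+ h)
prevOdd-≤-suc-double h = ℕₚ.m≤n⇒m≤1+n (prevOdd-≤-double h)

contractSources : ℕ → Fin 3 → ℕ
contractSources n = prevOdd n ∷ n ℕ.+ n ∷ suc (n ℕ.+ n) ∷ []

contractSources-lo : ∀ n → All (prevOdd n ℕ.≤_) (contractSources n)
contractSources-lo n = All₃ (prevOdd n ℕ.≤_) ℕₚ.≤-refl (prevOdd-≤-double n) (prevOdd-≤-suc-double n)

contractSources-hi : ∀ n → All (ℕ._≤ suc (n ℕ.+ n)) (contractSources n)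
contractSources-hi n = All₃ (ℕ._≤ suc (n ℕ.+ n)) (prevOdd-≤-suc-double n) (ℕₚ.n≤1+n _) ℕₚ.≤-refl

contractSources-mono : SourcesMonotone contractSources
contractSources-mono = sourcesMonotone-byIntervals contractSources prevOdd (λ n → suc (n ℕ.+ n))
  contractSources-lo contractSources-hi (λ { i (suc i') (s≤s i≤i') → s≤s (ℕₚ.+-mono-≤ i≤i' i≤i') })

splitSources : ℕ × Bool → Fin 2 → ℕ
splitSources (h , false) = h ∷ h ∷ []
splitSources (h , true)  = h ∷ suc h ∷ []

splitSources-mono : SourcesMonotone (λ i → splitSources (halve i))
splitSources-mono = sourcesMonotone-byIntervals (λ i → splitSources (halve i)) half (λ i → half (suc i))
  (λ i → lo (halve i)) hi (λ i i' i<i' → half-mono i<i')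
  where
  lo : ∀ hb → All (proj₁ hb ℕ.≤_) (splitSources hb)
  lo (h , false) = All₂ (h ℕ.≤_) ℕₚ.≤-refl ℕₚ.≤-refl
  lo (h , true)  = All₂ (h ℕ.≤_) ℕₚ.≤-refl (ℕₚ.n≤1+n h)
  hi : ∀ i → All (ℕ._≤ half (suc i)) (splitSources (halve i))
  hi i with halve i
  ... | h , false = All₂ (ℕ._≤ h) ℕₚ.≤-refl ℕₚ.≤-refl
  ... | h , true  = All₂ (ℕ._≤ suc h) (ℕₚ.n≤1+n h) ℕₚ.≤-refl

doubledContractSources : ℕ × Bool → Fin 3 → ℕ
doubledContractSources (h , false) = prevOdd h ∷ prevOdd h ∷ prevOdd h ∷ []
doubledContractSources (h , true)  = contractSources h

doubledContractSources-mono : SourcesMonotone (λ i → doubledContractSources (halve i))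
doubledContractSources-mono = sourcesMonotone-byIntervals (λ i → doubledContractSources (halve i))
  (λ i → prevOdd (half i)) (λ i → prevOdd (half (suc i))) lo hi
  (λ i i' i<i' → prevOdd-mono (half-mono i<i'))
  where
  lo : ∀ i → All (prevOdd (half i) ℕ.≤_) (doubledContractSources (halve i))
  lo i with halve i
  ... | h , false = All₃ (prevOdd h ℕ.≤_) ℕₚ.≤-refl ℕₚ.≤-refl ℕₚ.≤-refl
  ... | h , true  = contractSources-lo h
  hi : ∀ i → All (ℕ._≤ prevOdd (half (suc i))) (doubledContractSources (halve i))
  hi i with halve i
  ... | h , false = All₃ (ℕ._≤ prevOdd h) ℕₚ.≤-refl ℕₚ.≤-refl ℕₚ.≤-refl
  ... | h , true  = contractSources-hi h

n<2+n : ∀ n → n ℕ.< suc (suc n)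
n<2+n n = ℕₚ.m<n⇒m<1+n (ℕₚ.n<1+n n)

n<3+n : ∀ n → n ℕ.< suc (suc (suc n))
n<3+n n = ℕₚ.m<n⇒m<1+n (n<2+n n)

module Factorisations {r ℓ p} (R : POCommRing r ℓ p) where
  open POCommRing R
  open TotalPositivity R
  open import Relation.Binary.Reasoning.Setoid setoid
  open import Algebra.Properties.Group +-group using (//-rightDividesˡ)
  open import Algebra.Solver.Ring.NaturalCoefficients.Default commutativeSemiring

  unitRows-entries : ∀ {U D L₁ L₂ a b e f a' b' e' f'} → a ≡ a' → b ≡ b' → e ≡ e' → f ≡ f' →
    U * a' + D * b' + L₁ * e' + L₂ * f' ≈ U * a + D * b + L₁ * e + L₂ * f
  unitRows-entries ≡.refl ≡.refl ≡.refl ≡.refl = refl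

  band-cong : ∀ {u d l₁ l₂ u' d' l₁' l₂' : ℕ → Carrier} →
    (∀ n → u n ≈ u' n) → (∀ n → d n ≈ d' n) →
    (∀ n → l₁ (suc n) ≈ l₁' (suc n)) → (∀ n → l₂ (suc (suc n)) ≈ l₂' (suc (suc n))) →
    ∀ n m → band u d l₁ l₂ n m ≈ band u' d' l₁' l₂' n m
  band-cong u≈ d≈ l₁≈ l₂≈ n m with m ℕ.≟ suc n
  ... | yes _ = u≈ n
  ... | no  _ with m ℕ.≟ n
  ... | yes _ = d≈ n
  ... | no  _ with suc m ℕ.≟ n
  ... | yes ≡.refl = l₁≈ m
  ... | no  _ with suc (suc m) ℕ.≟ n
  ... | yes ≡.refl = l₂≈ m
  ... | no  _ = refl

  band-asUnitRows : ∀ (u d l₁ l₂ : ℕ → Carrier) n m → band u d l₁ l₂ n m ≈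
    u n * δ (suc n) m + d n * δ n m + l₁ n * δ n (suc m) + l₂ n * δ n (suc (suc m))
  band-asUnitRows u d l₁ l₂ n m with m ℕ.≟ suc n
  ... | yes ≡.refl =
    trans (solve 4 (λ U D L₁ L₂ → U := U :* con 1 :+ D :* con 0 :+ L₁ :* con 0 :+ L₂ :* con 0) refl _ _ _ _)
          (unitRows-entries (δ-diagonal n) (≢⇒δ≡0 (ℕₚ.<⇒≢ (ℕₚ.n<1+n n)))
                            (≢⇒δ≡0 (ℕₚ.<⇒≢ (n<2+n n))) (≢⇒δ≡0 (ℕₚ.<⇒≢ (n<3+n n))))
  ... | no m≢1+n with m ℕ.≟ n
  ... | yes ≡.refl =
    trans (solve 4 (λ U D L₁ L₂ → D := U :* con 0 :+ D :* con 1 :+ L₁ :* con 0 :+ L₂ :* con 0) refl _ _ _ _)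
          (unitRows-entries (≢⇒δ≡0 (ℕₚ.>⇒≢ (ℕₚ.n<1+n m))) (δ-diagonal m)
                            (≢⇒δ≡0 (ℕₚ.<⇒≢ (ℕₚ.n<1+n m))) (≢⇒δ≡0 (ℕₚ.<⇒≢ (n<2+n m))))
  ... | no m≢n with suc m ℕ.≟ n
  ... | yes ≡.refl =
    trans (solve 4 (λ U D L₁ L₂ → L₁ := U :* con 0 :+ D :* con 0 :+ L₁ :* con 1 :+ L₂ :* con 0) refl _ _ _ _)
          (unitRows-entries (≢⇒δ≡0 (ℕₚ.>⇒≢ (n<2+n m))) (≢⇒δ≡0 (ℕₚ.>⇒≢ (ℕₚ.n<1+n m)))
                            (δ-diagonal m) (≢⇒δ≡0 (ℕₚ.<⇒≢ (ℕₚ.n<1+n m))))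
  ... | no 1+m≢n with suc (suc m) ℕ.≟ n
  ... | yes ≡.refl =
    trans (solve 4 (λ U D L₁ L₂ → L₂ := U :* con 0 :+ D :* con 0 :+ L₁ :* con 0 :+ L₂ :* con 1) refl _ _ _ _)
          (unitRows-entries (≢⇒δ≡0 (ℕₚ.>⇒≢ (n<3+n m))) (≢⇒δ≡0 (ℕₚ.>⇒≢ (n<2+n m)))
                            (≢⇒δ≡0 (ℕₚ.>⇒≢ (ℕₚ.n<1+n m))) (δ-diagonal m))
  ... | no 2+m≢n =
    trans (solve 4 (λ U D L₁ L₂ → con 0 := U :* con 0 :+ D :* con 0 :+ L₁ :* con 0 :+ L₂ :* con 0) refl _ _ _ _)
          (unitRows-entries (≢⇒δ≡0 (m≢1+n ∘ ≡.sym)) (≢⇒δ≡0 (m≢n ∘ ≡.sym))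
                            (≢⇒δ≡0 (1+m≢n ∘ ≡.sym)) (≢⇒δ≡0 (2+m≢n ∘ ≡.sym)))

  rowCombination-halve : ∀ {K} (A : ℕ × Bool → Fin K → Carrier) (S : ℕ × Bool → Fin K → ℕ) (M : Matrix)
    i {hb} → halve i ≡ hb → ∀ j →
    rowCombination (λ i → A (halve i)) (λ i → S (halve i)) M i j ≡ Σᶠ (λ q → A hb q * M (S hb q) j)
  rowCombination-halve A S M i ≡.refl j = ≡.refl

  splitCoefficients : (ℕ → Carrier) → ℕ × Bool → Fin 2 → Carrier
  splitCoefficients g (h , false) = 1# ∷ 0# ∷ []
  splitCoefficients g (h , true)  = g h ∷ 1# ∷ []

  splitBidiagonal : (ℕ → Carrier) → Matrix
  splitBidiagonal g = rowCombination (λ i → splitCoefficients g (halve i)) (λ i → splitSources (halve i)) δ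

  splitBidiagonal-even : ∀ g h j → splitBidiagonal g (h ℕ.+ h) j ≈ δ h j
  splitBidiagonal-even g h j =
    trans (reflexive (rowCombination-halve (splitCoefficients g) splitSources δ (h ℕ.+ h) (halve-even h) j))
          (solve 2 (λ x y → con 1 :* x :+ (con 0 :* y :+ con 0) := x) refl _ _)

  splitBidiagonal-odd : ∀ g h j → splitBidiagonal g (suc (h ℕ.+ h)) j ≈ g h * δ h j + δ (suc h) j
  splitBidiagonal-odd g h j =
    trans (reflexive (rowCombination-halve (splitCoefficients g) splitSources δ (suc (h ℕ.+ h)) (halve-odd h) j))
          (solve 3 (λ a x y → a :* x :+ (con 1 :* y :+ con 0) := a :* x :+ y) refl _ _ _)

  splitBidiagonal-TP : ∀ g → (∀ h → 𝒫 (g h)) → TotallyPositive (splitBidiagonal g)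
  splitBidiagonal-TP g g≥0 =
    TotallyPositive-rowCombination {M = δ} (λ i → coefficients≥0 (halve i)) splitSources-mono δ-TP
    where
    coefficients≥0 : ∀ hb → All 𝒫 (splitCoefficients g hb)
    coefficients≥0 (h , false) = All₂ 𝒫 𝒫-1 𝒫-0
    coefficients≥0 (h , true)  = All₂ 𝒫 (g≥0 h) 𝒫-1

  contraction : (b c : ℕ → Carrier) → Matrix → Matrix
  contraction b c = rowCombination (λ n → b n ∷ c n ∷ 1# ∷ []) contractSources

  contraction-row : ∀ b c M n j →
    contraction b c M n j ≈ b n * M (prevOdd n) j + c n * M (n ℕ.+ n) j + M (suc (n ℕ.+ n)) j
  contraction-row b c M n j =
    solve 5 (λ b c x y z → b :* x :+ (c :* y :+ (con 1 :* z :+ con 0)) := b :* x :+ c :* y :+ z) refl _ _ _ _ _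

  contraction-TP : ∀ {b c : ℕ → Carrier} {M : Matrix} → (∀ n → 𝒫 (b n)) → (∀ n → 𝒫 (c n)) →
    TotallyPositive M → TotallyPositive (contraction b c M)
  contraction-TP {M = M} b≥0 c≥0 =
    TotallyPositive-rowCombination {M = M} (λ n → All₃ 𝒫 (b≥0 n) (c≥0 n) 𝒫-1) contractSources-mono

  contraction-splitBidiagonal : ∀ b c g n m → contraction b c (splitBidiagonal g) n m ≈
    band (λ _ → 1#) (λ n → b n + c n + g n) (λ n → b n * g (ℕ.pred n)) (λ _ → 0#) n m
  contraction-splitBidiagonal b c g zero m = begin
    contraction b c N 0 m
      ≈⟨ contraction-row b c N 0 m ⟩
    b 0 * N 0 m + c 0 * N 0 m + N 1 m
      ≈⟨ +-cong (+-cong (*-cong refl (splitBidiagonal-even g 0 m)) (*-cong refl (splitBidiagonal-even g 0 m)))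
                (splitBidiagonal-odd g 0 m) ⟩
    b 0 * δ 0 m + c 0 * δ 0 m + (g 0 * δ 0 m + δ 1 m)
      ≈⟨ solve 5 (λ b c g x y → b :* x :+ c :* x :+ (g :* x :+ y)
                                 := con 1 :* y :+ (b :+ c :+ g) :* x :+ b :* g :* con 0 :+ con 0 :* con 0)
                 refl (b 0) (c 0) (g 0) (δ 0 m) (δ 1 m) ⟩
    1# * δ 1 m + (b 0 + c 0 + g 0) * δ 0 m + b 0 * g 0 * 0# + 0# * 0#
      ≈⟨ band-asUnitRows _ _ _ _ 0 m ⟨
    band (λ _ → 1#) (λ n → b n + c n + g n) (λ n → b n * g (ℕ.pred n)) (λ _ → 0#) 0 m ∎
    where
    N : Matrix
    N = splitBidiagonal g
  contraction-splitBidiagonal b c g n@(suc k) m = begin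
    contraction b c N n m
      ≈⟨ contraction-row b c N n m ⟩
    b n * N (suc (k ℕ.+ k)) m + c n * N (n ℕ.+ n) m + N (suc (n ℕ.+ n)) m
      ≈⟨ +-cong (+-cong (*-cong refl (splitBidiagonal-odd g k m)) (*-cong refl (splitBidiagonal-even g n m)))
                (splitBidiagonal-odd g n m) ⟩
    b n * (g k * δ k m + δ n m) + c n * δ n m + (g n * δ n m + δ (suc n) m)
      ≈⟨ solve 8 (λ b c g₀ g₁ x y z w → b :* (g₀ :* x :+ y) :+ c :* y :+ (g₁ :* y :+ z)
                                         := con 1 :* z :+ (b :+ c :+ g₁) :* y :+ b :* g₀ :* x :+ con 0 :* w)
                 refl (b n) (c n) (g k) (g n) (δ k m) (δ n m) (δ (suc n) m) (δ k (suc m)) ⟩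
    1# * δ (suc n) m + (b n + c n + g n) * δ n m + b n * g k * δ k m + 0# * δ k (suc m)
      ≈⟨ band-asUnitRows _ _ _ _ n m ⟨
    band (λ _ → 1#) (λ n → b n + c n + g n) (λ n → b n * g (ℕ.pred n)) (λ _ → 0#) n m ∎
    where
    N : Matrix
    N = splitBidiagonal g

  ι-𝒫 : ∀ n → 𝒫 (ι n)
  ι-𝒫 zero    = 𝒫-0
  ι-𝒫 (suc n) = 𝒫-+ 𝒫-1 (ι-𝒫 n)

  doubledCoefficients : Carrier → Carrier → ℕ × Bool → Fin 3 → Carrier
  doubledCoefficients a y (h , false) = 1# ∷ 0# ∷ 0# ∷ []
  doubledCoefficients a y (h , true)  = ι h * y ∷ a * y ∷ 1# ∷ []

  doubledContraction : Carrier → Carrier → Matrix → Matrix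
  doubledContraction a y =
    rowCombination (λ i → doubledCoefficients a y (halve i)) (λ i → doubledContractSources (halve i))

  doubledContraction-even : ∀ a y M h j → doubledContraction a y M (h ℕ.+ h) j ≈ M (prevOdd h) j
  doubledContraction-even a y M h j =
    trans (reflexive (rowCombination-halve (doubledCoefficients a y) doubledContractSources M (h ℕ.+ h) (halve-even h) j))
          (solve 3 (λ x y z → con 1 :* x :+ (con 0 :* y :+ (con 0 :* z :+ con 0)) := x) refl _ _ _)

  doubledContraction-odd : ∀ a y M h j →
    doubledContraction a y M (suc (h ℕ.+ h)) j ≡ contraction (λ h → ι h * y) (λ _ → a * y) M h j
  doubledContraction-odd a y M h =
    rowCombination-halve (doubledCoefficients a y) doubledContractSources M (suc (h ℕ.+ h)) (halve-odd h)

  doubledContraction-TP : ∀ {a y M} → 𝒫 a → 𝒫 y → TotallyPositive M →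
    TotallyPositive (doubledContraction a y M)
  doubledContraction-TP {a} {y} {M} a≥0 y≥0 =
    TotallyPositive-rowCombination {M = M} (λ i → coefficients≥0 (halve i)) doubledContractSources-mono
    where
    coefficients≥0 : ∀ hb → All 𝒫 (doubledCoefficients a y hb)
    coefficients≥0 (h , false) = All₃ 𝒫 𝒫-1 𝒫-0 𝒫-0
    coefficients≥0 (h , true)  = All₃ 𝒫 (𝒫-* (ι-𝒫 h) y≥0) (𝒫-* a≥0 y≥0) 𝒫-1

  module ContractedRows (a y : Carrier) (g : ℕ → Carrier) (m : ℕ) where
    N : Matrix
    N = splitBidiagonal g
    Q : Matrix
    Q = doubledContraction a y N
    d′ l′ : ℕ → Carrier
    d′ n = ι n * y + a * y + g n
    l′ n = ι n * y * g (ℕ.pred n)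
    oddRow : ∀ h → Q (suc (h ℕ.+ h)) m ≈
      1# * δ (suc h) m + d′ h * δ h m + l′ h * δ h (suc m) + 0# * δ h (suc (suc m))
    oddRow h = trans (reflexive (doubledContraction-odd a y N h m))
      (trans (contraction-splitBidiagonal (λ h → ι h * y) (λ _ → a * y) g h m) (band-asUnitRows _ _ _ _ h m))

  contraction-doubledContraction-splitBidiagonal : ∀ a y b c g n m →
    let d′ = λ n → ι n * y + a * y + g n
        l′ = λ n → ι n * y * g (ℕ.pred n) in
    contraction b c (doubledContraction a y (splitBidiagonal g)) n m ≈
    band (λ _ → 1#) (λ n → b n + c n + d′ n)
         (λ n → b n * d′ (ℕ.pred n) + c n * g (ℕ.pred n) + l′ n) (λ n → b n * l′ (ℕ.pred n)) n m
  contraction-doubledContraction-splitBidiagonal a y b c g zero m = begin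
    contraction b c Q 0 m
      ≈⟨ contraction-row b c Q 0 m ⟩
    b 0 * Q 0 m + c 0 * Q 0 m + Q 1 m
      ≈⟨ +-cong (+-cong (*-cong refl row₀) (*-cong refl row₀)) (oddRow 0) ⟩
    b 0 * δ 0 m + c 0 * δ 0 m + (1# * δ 1 m + d′ 0 * δ 0 m + l′ 0 * 0# + 0# * 0#)
      ≈⟨ solve 8 (λ b c d l L₁ L₂ x z →
                     b :* x :+ c :* x :+ (con 1 :* z :+ d :* x :+ l :* con 0 :+ con 0 :* con 0)
                   := con 1 :* z :+ (b :+ c :+ d) :* x :+ L₁ :* con 0 :+ L₂ :* con 0)
                 refl (b 0) (c 0) (d′ 0) (l′ 0) _ _ (δ 0 m) (δ 1 m) ⟩
    _
      ≈⟨ band-asUnitRows _ _ _ _ 0 m ⟨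
    band (λ _ → 1#) (λ n → b n + c n + d′ n)
         (λ n → b n * d′ (ℕ.pred n) + c n * g (ℕ.pred n) + l′ n) (λ n → b n * l′ (ℕ.pred n)) 0 m ∎
    where
    open ContractedRows a y g m
    row₀ : Q 0 m ≈ δ 0 m
    row₀ = trans (doubledContraction-even a y N 0 m) (splitBidiagonal-even g 0 m)
  contraction-doubledContraction-splitBidiagonal a y b c g n@(suc k) m = begin
    contraction b c Q n m
      ≈⟨ contraction-row b c Q n m ⟩
    b n * Q (suc (k ℕ.+ k)) m + c n * Q (n ℕ.+ n) m + Q (suc (n ℕ.+ n)) m
      ≈⟨ +-cong (+-cong (*-cong refl (oddRow k))
                        (*-cong refl (trans (doubledContraction-even a y N n m) (splitBidiagonal-odd g k m))))
                (oddRow n) ⟩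
    b n * (1# * δ n m + d′ k * δ k m + l′ k * δ k (suc m) + 0# * δ k (suc (suc m)))
      + c n * (g k * δ k m + δ n m) + (1# * δ (suc n) m + d′ n * δ n m + l′ n * δ k m + 0# * δ k (suc m))
      ≈⟨ solve 12 (λ b c g d₀ l₀ d₁ l₁ x y z e f →
                     b :* (con 1 :* y :+ d₀ :* x :+ l₀ :* e :+ con 0 :* f) :+ c :* (g :* x :+ y)
                       :+ (con 1 :* z :+ d₁ :* y :+ l₁ :* x :+ con 0 :* e)
                   := con 1 :* z :+ (b :+ c :+ d₁) :* y :+ (b :* d₀ :+ c :* g :+ l₁) :* x :+ b :* l₀ :* e)
                 refl (b n) (c n) (g k) (d′ k) (l′ k) (d′ n) (l′ n)
                      (δ k m) (δ n m) (δ (suc n) m) (δ k (suc m)) (δ k (suc (suc m))) ⟩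
    _
      ≈⟨ band-asUnitRows _ _ _ _ n m ⟨
    band (λ _ → 1#) (λ n → b n + c n + d′ n)
         (λ n → b n * d′ (ℕ.pred n) + c n * g (ℕ.pred n) + l′ n) (λ n → b n * l′ (ℕ.pred n)) n m ∎
    where open ContractedRows a y g m

  x≈[x-y]+y : ∀ x y → x ≈ (x - y) + y
  x≈[x-y]+y x y = sym (//-rightDividesˡ y x)

  ≥0⇒𝒫 : ∀ {x} → x ≥ 0# → 𝒫 x
  ≥0⇒𝒫 {x} = 𝒫-resp (trans (sym (+-identityʳ (x - 0#))) (//-rightDividesˡ 0# x))

  ≥-swap-+ : ∀ {z x y} → z ≥ x + y → z ≥ y + x
  ≥-swap-+ = 𝒫-resp (+-cong refl (-‿cong (+-comm _ _)))

  P∘♭-TP : ∀ α y₁ y₂ yda ydd yfp → 1# + α ≥ 0# → (1# + α) * yfp ≥ (1# + α) * y₁ →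
    y₁ ≥ 0# → y₂ ≥ 0# → yda + ydd ≥ y₁ + y₂ → TotallyPositive (P∘♭ α y₁ y₂ yda ydd yfp)
  P∘♭-TP α y₁ y₂ yda ydd yfp 1+α≥0 f≥0 y₁≥0 y₂≥0 t≥0 =
    TotallyPositive-resp
      (λ n m → trans (contraction-splitBidiagonal b c g n m)
                     (band-cong (λ _ → refl) diagonal subdiagonal (λ _ → refl) n m))
      (contraction-TP {M = splitBidiagonal g} (λ n → 𝒫-* (ι-𝒫 n) (≥0⇒𝒫 y₂≥0))
                                              (λ n → 𝒫-+ f≥0 (𝒫-* (ι-𝒫 n) t≥0))
        (splitBidiagonal-TP g (λ h → 𝒫-* (𝒫-+ (ι-𝒫 h) (≥0⇒𝒫 1+α≥0)) (≥0⇒𝒫 y₁≥0))))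
    where
    A f t : Carrier
    A = 1# + α
    f = A * yfp - A * y₁
    t = (yda + ydd) - (y₁ + y₂)
    b c g : ℕ → Carrier
    b n = ι n * y₂
    c n = f + ι n * t
    g h = (ι h + A) * y₁
    diagonal : ∀ n → b n + c n + g n ≈ A * yfp + ι n * (yda + ydd)
    diagonal n = begin
      ι n * y₂ + (f + ι n * t) + (ι n + A) * y₁
        ≈⟨ solve 6 (λ i y₁ y₂ A f t → i :* y₂ :+ (f :+ i :* t) :+ (i :+ A) :* y₁
                                       := (f :+ A :* y₁) :+ i :* (t :+ (y₁ :+ y₂)))
                   refl (ι n) y₁ y₂ A f t ⟩
      (f + A * y₁) + ι n * (t + (y₁ + y₂))
        ≈⟨ +-cong (x≈[x-y]+y _ _) (*-cong refl (x≈[x-y]+y _ _)) ⟨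
      A * yfp + ι n * (yda + ydd) ∎
    subdiagonal : ∀ k → b (suc k) * g k ≈ ι (suc k) * (ι (suc k) + α) * y₁ * y₂
    subdiagonal k = solve 4 (λ i α y₁ y₂ → (con 1 :+ i) :* y₂ :* ((i :+ (con 1 :+ α)) :* y₁)
                                            := (con 1 :+ i) :* ((con 1 :+ i) :+ α) :* y₁ :* y₂)
                            refl (ι k) α y₁ y₂

  P♭-TP : ∀ α y₁ y₂ yda ydd yfp x → 1# + α ≥ 0# → (1# + α) * yfp ≈ (1# + α) * y₁ →
    y₁ ≥ 0# → y₂ ≥ 0# → yda + ydd ≥ y₁ + y₂ → x ≥ 0# →
    TotallyPositive (P♭ α y₁ y₂ yda ydd yfp x)
  P♭-TP α y₁ y₂ yda ydd yfp x 1+α≥0 fp≈ y₁≥0 y₂≥0 t≥0 x≥0 =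
    TotallyPositive-resp
      (λ n m → trans (contraction-doubledContraction-splitBidiagonal A y₁ b c (λ _ → x) n m)
                     (band-cong (λ _ → refl) diagonal subdiagonal subsubdiagonal n m))
      (contraction-TP {M = doubledContraction A y₁ N} (λ n → 𝒫-* (ι-𝒫 n) (≥0⇒𝒫 y₂≥0)) (λ n → 𝒫-* (ι-𝒫 n) t≥0)
        (doubledContraction-TP {M = N} (≥0⇒𝒫 1+α≥0) (≥0⇒𝒫 y₁≥0)
          (splitBidiagonal-TP (λ _ → x) (λ _ → ≥0⇒𝒫 x≥0))))
    where
    A t : Carrier
    A = 1# + α
    t = (yda + ydd) - (y₁ + y₂)
    b c : ℕ → Carrier
    b n = ι n * y₂
    c n = ι n * t
    N : Matrix
    N = splitBidiagonal (λ _ → x)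
    diagonal : ∀ n → b n + c n + (ι n * y₁ + A * y₁ + x) ≈ A * yfp + ι n * (yda + ydd) + x
    diagonal n = begin
      ι n * y₂ + ι n * t + (ι n * y₁ + A * y₁ + x)
        ≈⟨ solve 6 (λ i y₁ y₂ A t x → i :* y₂ :+ i :* t :+ (i :* y₁ :+ A :* y₁ :+ x)
                                       := A :* y₁ :+ i :* (t :+ (y₁ :+ y₂)) :+ x)
                   refl (ι n) y₁ y₂ A t x ⟩
      A * y₁ + ι n * (t + (y₁ + y₂)) + x
        ≈⟨ +-cong (+-cong fp≈ (*-cong refl (x≈[x-y]+y _ _))) refl ⟨
      A * yfp + ι n * (yda + ydd) + x ∎
    subdiagonal : ∀ k → b (suc k) * (ι k * y₁ + A * y₁ + x) + c (suc k) * x + ι (suc k) * y₁ * x ≈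
                        ι (suc k) * (ι (suc k) + α) * y₁ * y₂ + ι (suc k) * (yda + ydd) * x
    subdiagonal k = begin
      (1# + ι k) * y₂ * (ι k * y₁ + (1# + α) * y₁ + x) + (1# + ι k) * t * x + (1# + ι k) * y₁ * x
        ≈⟨ solve 6 (λ i α y₁ y₂ t x → (con 1 :+ i) :* y₂ :* (i :* y₁ :+ (con 1 :+ α) :* y₁ :+ x)
                                        :+ (con 1 :+ i) :* t :* x :+ (con 1 :+ i) :* y₁ :* x
                                      := (con 1 :+ i) :* ((con 1 :+ i) :+ α) :* y₁ :* y₂
                                           :+ (con 1 :+ i) :* (t :+ (y₁ :+ y₂)) :* x)
                   refl (ι k) α y₁ y₂ t x ⟩
      (1# + ι k) * ((1# + ι k) + α) * y₁ * y₂ + (1# + ι k) * (t + (y₁ + y₂)) * x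
        ≈⟨ +-cong refl (*-cong (*-cong refl (x≈[x-y]+y _ _)) refl) ⟨
      ι (suc k) * (ι (suc k) + α) * y₁ * y₂ + ι (suc k) * (yda + ydd) * x ∎
    subsubdiagonal : ∀ k → b (suc (suc k)) * (ι (suc k) * y₁ * x) ≈ ι (suc (suc k)) * ι (suc k) * y₁ * y₂ * x
    subsubdiagonal k = solve 5 (λ n i y₁ y₂ x → n :* y₂ :* (i :* y₁ :* x) := n :* i :* y₁ :* y₂ :* x)
                               refl (ι (suc (suc k))) (ι (suc k)) y₁ y₂ x

  x*y*z≈x*z*y : ∀ x y z → x * y * z ≈ x * z * y
  x*y*z≈x*z*y = solve 3 (λ x y z → x :* y :* z := x :* z :* y) refl

  P∘♭-swap : ∀ α yp yv yda ydd yfp n m → P∘♭ α yv yp yda ydd yfp n m ≈ P∘♭ α yp yv yda ydd yfp n m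
  P∘♭-swap α yp yv yda ydd yfp =
    band-cong (λ _ → refl) (λ _ → refl) (λ n → x*y*z≈x*z*y _ yv yp) (λ _ → refl)

  P♭-swap : ∀ α yp yv yda ydd yfp x n m → P♭ α yv yp yda ydd yfp x n m ≈ P♭ α yp yv yda ydd yfp x n m
  P♭-swap α yp yv yda ydd yfp x =
    band-cong (λ _ → refl) (λ _ → refl) (λ n → +-cong (x*y*z≈x*z*y _ yv yp) refl)
              (λ n → *-cong (x*y*z≈x*z*y _ yv yp) refl)

proposition1p6 : ∀ {c ℓ p} (R : POCommRing c ℓ p) → let open POCommRing R in
    ∀ (α yp yv yda ydd yfp x : Carrier) →
    -- (a), together with its variant with y_p and y_v interchanged
    ((1# + α ≥ 0#) →
     (((1# + α) * yfp ≥ (1# + α) * yp) ⊎ ((1# + α) * yfp ≥ (1# + α) * yv)) →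
     yp ≥ 0# → yv ≥ 0# → (yda + ydd ≥ yp + yv) →
     TotallyPositive (P∘♭ α yp yv yda ydd yfp))
    ×
    -- (b), together with its variant with y_p and y_v interchanged
    ((1# + α ≥ 0#) →
     (((1# + α) * yfp ≈ (1# + α) * yp) ⊎ ((1# + α) * yfp ≈ (1# + α) * yv)) →
     yp ≥ 0# → yv ≥ 0# → (yda + ydd ≥ yp + yv) → x ≥ 0# →
     TotallyPositive (P♭ α yp yv yda ydd yfp x))
proposition1p6 R α yp yv yda ydd yfp x =
  (λ { 1+α≥0 (inj₁ fp≥p) p≥0 v≥0 S≥p+v → P∘♭-TP α yp yv yda ydd yfp 1+α≥0 fp≥p p≥0 v≥0 S≥p+v
     ; 1+α≥0 (inj₂ fp≥v) p≥0 v≥0 S≥p+v →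
         TotallyPositive-resp (P∘♭-swap α yp yv yda ydd yfp)
           (P∘♭-TP α yv yp yda ydd yfp 1+α≥0 fp≥v v≥0 p≥0 (≥-swap-+ S≥p+v)) })
  ,
  (λ { 1+α≥0 (inj₁ fp≈p) p≥0 v≥0 S≥p+v x≥0 → P♭-TP α yp yv yda ydd yfp x 1+α≥0 fp≈p p≥0 v≥0 S≥p+v x≥0
     ; 1+α≥0 (inj₂ fp≈v) p≥0 v≥0 S≥p+v x≥0 →
         TotallyPositive-resp (P♭-swap α yp yv yda ydd yfp x)
           (P♭-TP α yv yp yda ydd yfp x 1+α≥0 fp≈v v≥0 p≥0 (≥-swap-+ S≥p+v) x≥0) })
  where
  open TotalPositivity R
  open Factorisations R
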